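{- Let $n,t\in\mathbb N$ with $1\le t<n/2$. Suppose $D$ is an $n$-vertex $t$-bipseudorandom digraph with $\delta^0(D)\ge 2t+1$. Then for every oriented path $P$ with $3$ edges and every pair of distinct vertices $v,v'\in V(D)$, there is a copy of $P$ in $D$ with startpoint $v$ and endpoint $v'$.
   Context: $\delta^0(D)$ is the minimum over all vertices of all in- and outdegrees. For $1\le t\le n/2$, an $n$-vertex digraph $D$ is $t$-bipseudorandom if for every pair of disjoint sets $U,W\subseteq V(D)$ with $|U|=|W|=t$ there exist $u\in U$, $w\in W$ with both $uw$ and $wu$ edges of $D$. An oriented path $P=(u_1,\dots,u_k)$ is obtained from an undirected path by replacing each edge $u_iu_{i+1}$ by exactly one of $u_iu_{i+1}$ or $u_{i+1}u_i$; $u_1$ is its startpoint and $u_k$ its endpoint. A copy of $P$ in $D$ with startpoint $v$ and endpoint $v'$ is a sequence of distinct vertices $(v_1,\dots,v_k)$ of $D$ with $v_1=v$, $v_k=v'$, such that for each $i$, $v_iv_{i+1}\in E(D)$ if $u_iu_{i+1}\in E(P)$ and $v_{i+1}v_i\in E(D)$ if $u_{i+1}u_i\in E(P)$. -}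

module Defs where

open import Data.Nat using (ℕ; suc; _≤_; _<_; _*_; _+_)
open import Data.Bool using (Bool; true; false)
open import Data.Fin using (Fin)
open import Data.Fin.Subset using (Subset; ∣_∣; _∈_; Empty; _∩_)
open import Data.Vec using (Vec; tabulate; lookup; _∷_; [])
open import Data.Product using (Σ; ∃; ∃-syntax; _×_; _,_)
open import Relation.Binary.PropositionalEquality using (_≡_; _≢_)
open import Relation.Nullary using (¬_)

-- A digraph on vertex set Fin n: adjacency matrix, loopless.
-- (Directed graphs are simple: no loops, no multiple edges; antiparallel edges allowed.)
record Digraph (n : ℕ) : Set where
  field
    adj      : Fin n → Fin n → Bool
    loopless : ∀ v → adj v v ≡ false

open Digraph public

Edge : ∀ {n} → Digraph n → Fin n → Fin n → Set
Edge D u w = adj D u w ≡ true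

outNbhd : ∀ {n} → Digraph n → Fin n → Subset n
outNbhd D v = tabulate (λ w → adj D v w)

inNbhd : ∀ {n} → Digraph n → Fin n → Subset n
inNbhd D v = tabulate (λ u → adj D u v)

outdeg indeg : ∀ {n} → Digraph n → Fin n → ℕ
outdeg D v = ∣ outNbhd D v ∣
indeg  D v = ∣ inNbhd D v ∣

MinSemiDegreeAtLeast : ∀ {n} → Digraph n → ℕ → Set
MinSemiDegreeAtLeast D k = ∀ v → (k ≤ outdeg D v) × (k ≤ indeg D v)

Disjoint : ∀ {n} → Subset n → Subset n → Set
Disjoint U W = Empty (U ∩ W)

Bipseudorandom : ∀ {n} → ℕ → Digraph n → Set
Bipseudorandom {n} t D =
  ∀ (U W : Subset n) → Disjoint U W → ∣ U ∣ ≡ t → ∣ W ∣ ≡ t →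
  ∃[ u ] ∃[ w ] (u ∈ U × w ∈ W × Edge D u w × Edge D w u)

-- An oriented path with k edges: entry i is true if edge u_i u_{i+1} is
-- oriented forwards (u_i → u_{i+1}), false if backwards (u_{i+1} → u_i).
OrientedPath : ℕ → Set
OrientedPath k = Vec Bool k

Oriented : ∀ {n} → Digraph n → Bool → Fin n → Fin n → Set
Oriented D true  a b = Edge D a b
Oriented D false a b = Edge D b a

CopyOf3Path : ∀ {n} → Digraph n → OrientedPath 3 → Fin n → Fin n → Set
CopyOf3Path {n} D (o₁ ∷ o₂ ∷ o₃ ∷ []) v v' =
  Σ (Fin n) λ v₂ → Σ (Fin n) λ v₃ →
    (v ≢ v₂) × (v ≢ v₃) × (v ≢ v') × (v₂ ≢ v₃) × (v₂ ≢ v') × (v₃ ≢ v') ×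
    Oriented D o₁ v v₂ × Oriented D o₂ v₂ v₃ × Oriented D o₃ v₃ v'

-- Let N(v) and N(v') be the neighbourhoods of v and v' along the first and last edge of P.
-- Take U ⊆ N(v) ∖ {v'} of size t, then W ⊆ N(v') ∖ ({v} ∪ U) of size t; both exist
-- because these neighbourhoods have at least 2t + 1 vertices. Bipseudorandomness
-- gives u ∈ U, w ∈ W joined in both directions, so v u w v' is a copy of P whatever the
-- orientation of its middle edge; distinctness comes from the choice of U and W and from
-- looplessness.
module Submission where

open import Defs
open import Data.Nat using (ℕ; _≤_; _<_; _*_; _+_)
open import Data.Fin using (Fin)
open import Relation.Binary.PropositionalEquality using (_≢_)

open import Data.Nat using (zero; suc; z≤n; s≤s)
open import Data.Nat.Properties using (≤-trans; ≤-reflexive; +-cancelʳ-≤; +-identityʳ; +-suc; m≤m+n; m≤n⇒m≤1+n)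
open import Data.Bool using (Bool; true; false; not)
open import Data.Fin.Subset using (Subset; ∣_∣; _∈_; _∉_; _⊆_; _─_; _-_; ⁅_⁆; ⊥; inside; outside)
open import Data.Fin.Subset.Properties
  using (⊆-min; ∣⊥∣≡0; out⊆; s⊆s; p─q⊆p; x∈p∩q⁻; ∣⁅x⁆∣≡1; x∉⁅y⁆⇒x≢y)
open import Data.Vec using (_∷_; []; tabulate; here; there)
open import Data.Vec.Properties using ([]=⇒lookup; lookup∘tabulate)
open import Data.Product using (∃-syntax; _×_; _,_)
open import Relation.Binary.PropositionalEquality using (_≡_; refl; sym; trans; cong; subst)
open import Function using (_∘_)

private
  variable
    n : ℕ

∃⊆-ofSize : ∀ k (p : Subset n) → k ≤ ∣ p ∣ → ∃[ q ] q ⊆ p × ∣ q ∣ ≡ k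
∃⊆-ofSize {n} zero p _ = ⊥ , ⊆-min p , ∣⊥∣≡0 n
∃⊆-ofSize (suc k) (outside ∷ p) k<∣p∣ with ∃⊆-ofSize (suc k) p k<∣p∣
... | q , q⊆p , ∣q∣≡k = outside ∷ q , out⊆ q⊆p , ∣q∣≡k
∃⊆-ofSize (suc k) (inside ∷ p) (s≤s k≤∣p∣) with ∃⊆-ofSize k p k≤∣p∣
... | q , q⊆p , ∣q∣≡k = inside ∷ q , s⊆s q⊆p , cong suc ∣q∣≡k

x∈p─q⇒x∉q : ∀ {x : Fin n} (p q : Subset n) → x ∈ p ─ q → x ∉ q
x∈p─q⇒x∉q (_ ∷ p) (outside ∷ q) (there x∈p─q) (there x∈q) = x∈p─q⇒x∉q p q x∈p─q x∈q
x∈p─q⇒x∉q (_ ∷ p) (inside ∷ q)  (there x∈p─q) (there x∈q) = x∈p─q⇒x∉q p q x∈p─q x∈q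

∣p∣≤∣p─q∣+∣q∣ : ∀ (p q : Subset n) → ∣ p ∣ ≤ ∣ p ─ q ∣ + ∣ q ∣
∣p∣≤∣p─q∣+∣q∣ []            []            = z≤n
∣p∣≤∣p─q∣+∣q∣ (outside ∷ p) (outside ∷ q) = ∣p∣≤∣p─q∣+∣q∣ p q
∣p∣≤∣p─q∣+∣q∣ (inside ∷ p)  (outside ∷ q) = s≤s (∣p∣≤∣p─q∣+∣q∣ p q)
∣p∣≤∣p─q∣+∣q∣ (outside ∷ p) (inside ∷ q)  =
  ≤-trans (m≤n⇒m≤1+n (∣p∣≤∣p─q∣+∣q∣ p q)) (≤-reflexive (sym (+-suc _ _)))
∣p∣≤∣p─q∣+∣q∣ (inside ∷ p)  (inside ∷ q)  =
  ≤-trans (s≤s (∣p∣≤∣p─q∣+∣q∣ p q)) (≤-reflexive (sym (+-suc _ _)))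

k+1≤∣p∣⇒k≤∣p-x∣ : ∀ {k} (p : Subset n) x → k + 1 ≤ ∣ p ∣ → k ≤ ∣ p - x ∣
k+1≤∣p∣⇒k≤∣p-x∣ {k = k} p x k+1≤∣p∣ = +-cancelʳ-≤ 1 k ∣ p - x ∣
  (≤-trans k+1≤∣p∣ (≤-trans (∣p∣≤∣p─q∣+∣q∣ p ⁅ x ⁆) (≤-reflexive (cong (∣ p - x ∣ +_) (∣⁅x⁆∣≡1 x)))))

x∈tabulate⇒true : ∀ (f : Fin n → Bool) {x} → x ∈ tabulate f → f x ≡ true
x∈tabulate⇒true f {x} x∈f = trans (sym (lookup∘tabulate f x)) ([]=⇒lookup x∈f)

module _ (D : Digraph n) where

  nbhd : Bool → Fin n → Subset n
  nbhd true  v = outNbhd D v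
  nbhd false v = inNbhd D v

  x∈nbhd⇒Oriented : ∀ o {v x} → x ∈ nbhd o v → Oriented D o v x
  x∈nbhd⇒Oriented true  {v} = x∈tabulate⇒true (adj D v)
  x∈nbhd⇒Oriented false {v} = x∈tabulate⇒true (λ u → adj D u v)

  δ⁰≤∣nbhd∣ : ∀ {k} → MinSemiDegreeAtLeast D k → ∀ o v → k ≤ ∣ nbhd o v ∣
  δ⁰≤∣nbhd∣ δ⁰ true  v = let (k≤out , _) = δ⁰ v in k≤out
  δ⁰≤∣nbhd∣ δ⁰ false v = let (_ , k≤in) = δ⁰ v in k≤in

  Oriented-not⁻ : ∀ o {x y} → Oriented D (not o) y x → Oriented D o x y
  Oriented-not⁻ true  e = e
  Oriented-not⁻ false e = e

  Oriented-both : ∀ o {x y} → Edge D x y → Edge D y x → Oriented D o x y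
  Oriented-both true  xy _  = xy
  Oriented-both false _  yx = yx

  Edge⇒≢ : ∀ {x y} → Edge D x y → x ≢ y
  Edge⇒≢ {x} xx refl with trans (sym xx) (loopless D x)
  ... | ()

  Oriented⇒≢ : ∀ o {x y} → Oriented D o x y → x ≢ y
  Oriented⇒≢ true  e = Edge⇒≢ e
  Oriented⇒≢ false e = Edge⇒≢ e ∘ sym

  bipseudorandom⇒doubleEdge : ∀ {t} → Bipseudorandom t D → (A B : Subset n) →
    t ≤ ∣ A ∣ → 2 * t ≤ ∣ B ∣ →
    ∃[ u ] ∃[ w ] (u ∈ A × w ∈ B × Edge D u w × Edge D w u)
  bipseudorandom⇒doubleEdge {t} bp A B t≤∣A∣ 2t≤∣B∣
    with ∃⊆-ofSize t A t≤∣A∣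
  ... | U , U⊆A , ∣U∣≡t
    with ∃⊆-ofSize t (B ─ U) t≤∣B─U∣
    where
    t≤∣B─U∣ : t ≤ ∣ B ─ U ∣
    t≤∣B─U∣ = +-cancelʳ-≤ t t ∣ B ─ U ∣ (≤-trans
      (subst (_≤ ∣ B ∣) (cong (t +_) (+-identityʳ t)) 2t≤∣B∣)
      (≤-trans (∣p∣≤∣p─q∣+∣q∣ B U) (≤-reflexive (cong (∣ B ─ U ∣ +_) ∣U∣≡t))))
  ... | W , W⊆B─U , ∣W∣≡t
    with bp U W disjoint ∣U∣≡t ∣W∣≡t
    where
    disjoint : Disjoint U W
    disjoint (x , x∈U∩W) with x∈p∩q⁻ U W x∈U∩W
    ... | x∈U , x∈W = x∈p─q⇒x∉q B U (W⊆B─U x∈W) x∈U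
  ... | u , w , u∈U , w∈W , uw , wu = u , w , U⊆A u∈U , p─q⊆p B U (W⊆B─U w∈W) , uw , wu

proposition4p3 : (n t : ℕ) → 1 ≤ t → 2 * t < n →
    (D : Digraph n) → Bipseudorandom t D →
    MinSemiDegreeAtLeast D (2 * t + 1) →
    (P : OrientedPath 3) → (v v' : Fin n) → v ≢ v' →
    CopyOf3Path D P v v'
proposition4p3 n t _ _ D bp δ⁰ (o₁ ∷ o₂ ∷ o₃ ∷ []) v v' v≢v'
  with bipseudorandom⇒doubleEdge D bp (nbhd D o₁ v - v') (nbhd D (not o₃) v' - v)
         (≤-trans (m≤m+n t (t + 0)) (2t≤∣nbhd-x∣ o₁ v v')) (2t≤∣nbhd-x∣ (not o₃) v' v)
  where
  2t≤∣nbhd-x∣ : ∀ o y x → 2 * t ≤ ∣ nbhd D o y - x ∣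
  2t≤∣nbhd-x∣ o y x = k+1≤∣p∣⇒k≤∣p-x∣ (nbhd D o y) x (δ⁰≤∣nbhd∣ D δ⁰ o y)
... | u , w , u∈A , w∈B , uw , wu =
  u , w , Oriented⇒≢ D o₁ vu , v≢w , v≢v' , Oriented⇒≢ D o₂ uw' , u≢v' , Oriented⇒≢ D o₃ wv' ,
  vu , uw' , wv'
  where
  vu : Oriented D o₁ v u
  vu = x∈nbhd⇒Oriented D o₁ (p─q⊆p _ ⁅ v' ⁆ u∈A)
  uw' : Oriented D o₂ u w
  uw' = Oriented-both D o₂ uw wu
  wv' : Oriented D o₃ w v'
  wv' = Oriented-not⁻ D o₃ (x∈nbhd⇒Oriented D (not o₃) (p─q⊆p _ ⁅ v ⁆ w∈B))
  u≢v' : u ≢ v'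
  u≢v' = x∉⁅y⁆⇒x≢y (x∈p─q⇒x∉q _ ⁅ v' ⁆ u∈A)
  v≢w : v ≢ w
  v≢w v≡w = x∉⁅y⁆⇒x≢y (x∈p─q⇒x∉q _ ⁅ v ⁆ w∈B) (sym v≡w)
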